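{- Let $k$ be a nonnegative integer and let $G=(V_G,E_G)$ and $H=(V_H,E_H)$ be graphs. Let $A\subseteq V_G$ and $B\subseteq V_H$ be such that (i) $G-A=H-B$ and (ii) $N_G[A]\setminus A=N_H[B]\setminus B$. Then 1) $A$ is a $k$-power dominating set of $G$ if and only if $B$ is a $k$-power dominating set of $H$; 2) $N_G[A]$ is a $k$-forcing set of $G$ if and only if $N_H[B]$ is a $k$-forcing set of $H$.
   Context: Graphs are finite, simple and undirected; $N_G[S]=\bigcup_{v\in S}(N_G(v)\cup\{v\})$; $G-A$ is the subgraph induced by $V_G\setminus A$. For a graph $G=(V,E)$, nonnegative integer $k$ and $T\subseteq V$: $\mathscr F^0_{G,k}(T)=T$, $\mathscr F^{i+1}_{G,k}(T)=\mathscr F^i_{G,k}(T)\cup\bigcup\{N(v): v\in \mathscr F^i_{G,k}(T),\ 1\le |N(v)\setminus \mathscr F^i_{G,k}(T)|\le k\}$; $T$ is a $k$-forcing set of $G$ if $\mathscr F^t_{G,k}(T)=V$ for some $t$. $\mathscr P^0_{G,k}(S)=N[S]$ with $\mathscr P^{i+1}_{G,k}(S)$ defined by the same rule; $S$ is a $k$-power dominating set of $G$ if $\mathscr P^\ell_{G,k}(S)=V$ for some $\ell$. -}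

module Defs where

open import Data.Nat using (ℕ; zero; suc; _≤ᵇ_)
open import Data.Bool using (Bool; true; false; _∧_; _∨_; not)
open import Data.List using (List; filter; length)
open import Data.Bool.ListAction using (any)
open import Data.List.Membership.Propositional using (_∈_)
open import Data.List.Relation.Unary.Unique.Propositional using (Unique)
open import Data.Product using (_×_; ∃-syntax)
open import Function.Bundles using (_⇔_)
open import Relation.Binary.PropositionalEquality using (_≡_)
open import Relation.Nullary.Decidable using (yes; no)
open import Data.Bool.Properties using (T?)

-- Vertices are drawn from the common universe ℕ, so that two graphs can
-- share vertices (needed to state G - A = H - B).
-- A vertex subset is a Boolean predicate ℕ → Bool.
VSet : Set
VSet = ℕ → Bool

record Graph : Set where
  field
    V       : List ℕ
    V-uniq  : Unique V
    adj     : ℕ → ℕ → Bool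
    adj-sym : ∀ u v → adj u v ≡ adj v u
    adj-irr : ∀ v → adj v v ≡ false
    adj-V   : ∀ u v → adj u v ≡ true → u ∈ V
open Graph public

_⊆V_ : VSet → Graph → Set
S ⊆V G = ∀ v → S v ≡ true → v ∈ V G

closedNbhd : Graph → VSet → VSet
closedNbhd G S u = S u ∨ any (λ v → S v ∧ adj G v u) (V G)

outDeg : Graph → VSet → ℕ → ℕ
outDeg G F v = length (filter (λ u → T? (adj G v u ∧ not (F u))) (V G))

active : Graph → ℕ → VSet → ℕ → Bool
active G k F v = (1 ≤ᵇ outDeg G F v) ∧ (outDeg G F v ≤ᵇ k)

forceStep : Graph → ℕ → VSet → VSet
forceStep G k F u = F u ∨ any (λ v → F v ∧ active G k F v ∧ adj G v u) (V G)

forceIter : Graph → ℕ → ℕ → VSet → VSet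
forceIter G k zero    T = T
forceIter G k (suc i) T = forceStep G k (forceIter G k i T)

EqualsV : Graph → VSet → Set
EqualsV G S = ∀ v → (S v ≡ true) ⇔ (v ∈ V G)

IsKForcingSet : Graph → ℕ → VSet → Set
IsKForcingSet G k T = ∃[ t ] EqualsV G (forceIter G k t T)

powerIter : Graph → ℕ → ℕ → VSet → VSet
powerIter G k ℓ S = forceIter G k ℓ (closedNbhd G S)

IsKPowerDomSet : Graph → ℕ → VSet → Set
IsKPowerDomSet G k S = ∃[ ℓ ] EqualsV G (powerIter G k ℓ S)

-- G - A = H - B : same vertex set V_G \ A = V_H \ B and same edges on it
InV∖ : Graph → VSet → ℕ → Set
InV∖ G A v = (v ∈ V G) × (A v ≡ false)

DeleteEq : Graph → VSet → Graph → VSet → Set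
DeleteEq G A H B =
  (∀ v → InV∖ G A v ⇔ InV∖ H B v) ×
  (∀ u v → InV∖ G A u → InV∖ G A v → adj G u v ≡ adj H u v)

BoundaryEq : Graph → VSet → Graph → VSet → Set
BoundaryEq G A H B = ∀ v → (closedNbhd G A v ∧ not (A v)) ≡ (closedNbhd H B v ∧ not (B v))

-- Once a stage F of the forcing process contains N[A], a vertex outside F is
-- neither in A nor adjacent to A, and neither is any vertex that could force
-- it.  So starting from N_G[A] and N_H[B], which agree on the common part
-- G - A = H - B by (ii), the two processes stay equal on the common part step
-- by step: a forcing vertex there sees the same unforced neighbours, hence the
-- same out-degree, in G and in H.  One process fills its graph exactly when
-- the other does.
module Submission where

open import Defs
open import Data.Nat using (ℕ; zero; suc; _≤ᵇ_)
open import Data.Bool using (Bool; true; false; _∧_; _∨_; not)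
open import Data.Bool.Properties using (T?; T-≡; T-not-≡; T-∧; ∧-identityʳ; ⇔→≡)
open import Data.Bool.ListAction using (any)
open import Data.Sum using (_⊎_; inj₁; inj₂)
open import Data.Product using (_×_; _,_; proj₁; proj₂; ∃-syntax)
open import Data.List using (List; filter; length)
open import Data.List.Membership.Propositional using (_∈_; find; lose)
open import Data.List.Membership.Propositional.Properties using (∈-filter⁻; ∈-filter⁺)
open import Data.List.Membership.Propositional.Properties.WithK using (unique∧set⇒bag)
open import Data.List.Relation.Unary.Any.Properties using (any⁺; any⁻)
open import Data.List.Relation.Unary.Unique.Propositional using (Unique)
open import Data.List.Relation.Unary.Unique.Propositional.Properties using (filter⁺)
open import Data.List.Relation.Binary.BagAndSetEquality using (∼bag⇒↭)
open import Data.List.Relation.Binary.Permutation.Propositional.Properties using (↭-length)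
open import Function.Bundles using (_⇔_; mk⇔; Equivalence)
open import Function.Construct.Symmetry using (⇔-sym)
open import Relation.Binary.PropositionalEquality using (_≡_; refl; sym; trans; cong; module ≡-Reasoning)

open Equivalence

private
  variable
    G H : Graph
    A B S F F′ : VSet
    k u v : ℕ

_⊆ˢ_ : VSet → VSet → Set
S ⊆ˢ F = ∀ u → S u ≡ true → F u ≡ true

⊆ˢ-false : S ⊆ˢ F → F u ≡ false → S u ≡ false
⊆ˢ-false {S} {u = u} S⊆F Fu≡false with S u in Su
... | false = refl
... | true  = trans (sym (S⊆F u Su)) Fu≡false

∨-trueˡ : ∀ {a} b → a ≡ true → a ∨ b ≡ true
∨-trueˡ b refl = refl

∨-trueʳ : ∀ a {b} → b ≡ true → a ∨ b ≡ true
∨-trueʳ true  _ = refl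
∨-trueʳ false e = e

∧-true⇔ : ∀ {a b} → a ∧ b ≡ true ⇔ (a ≡ true × b ≡ true)
∧-true⇔ {true}  = mk⇔ (λ e → refl , e) proj₂
∧-true⇔ {false} = mk⇔ (λ ()) (λ ())

any-true⇔ : ∀ {X : Set} (p : X → Bool) xs → any p xs ≡ true ⇔ (∃[ x ] x ∈ xs × p x ≡ true)
any-true⇔ p xs = mk⇔
  (λ e → let x , x∈xs , px = find (any⁻ p xs (from T-≡ e)) in x , x∈xs , to T-≡ px)
  (λ (x , x∈xs , px) → to T-≡ (any⁺ p (lose x∈xs (from T-≡ px))))

length-≡-if-same-elements : ∀ {X : Set} {xs ys : List X} → Unique xs → Unique ys →
  (∀ x → x ∈ xs ⇔ x ∈ ys) → length xs ≡ length ys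
length-≡-if-same-elements uxs uys same =
  ↭-length (∼bag⇒↭ (unique∧set⇒bag uxs uys (λ {x} → same x)))

adj⇒∈V : adj G v u ≡ true → u ∈ V G
adj⇒∈V {G} {v} {u} e = adj-V G u v (trans (adj-sym G u v) e)

⊆closedNbhd : S ⊆ˢ closedNbhd G S
⊆closedNbhd u e = ∨-trueˡ _ e

closedNbhd-false⇒∉ : closedNbhd G S u ≡ false → S u ≡ false
closedNbhd-false⇒∉ {G} {S} = ⊆ˢ-false (⊆closedNbhd {S} {G})

closedNbhd-false⇒nbr∉ : closedNbhd G S u ≡ false → adj G v u ≡ true → S v ≡ false
closedNbhd-false⇒nbr∉ {G} {S} {u} {v} N[S]u≡false vu with S v in Sv
... | false = refl
... | true  = trans (sym N[S]u≡true) N[S]u≡false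
  where
    N[S]u≡true : closedNbhd G S u ≡ true
    N[S]u≡true with S u
    ... | true  = refl
    ... | false = from (any-true⇔ _ (V G))
                    (v , adj-V G v u vu , trans (cong (_∧ adj G v u) Sv) vu)

closedNbhd-⊆V : S ⊆V G → closedNbhd G S ⊆V G
closedNbhd-⊆V {S} {G} S⊆V u e with S u in Su
... | true  = S⊆V u Su
... | false = let v , _ , Sv∧vu = to (any-true⇔ _ (V G)) e
              in adj⇒∈V {G} {v} (proj₂ (to ∧-true⇔ Sv∧vu))

Forces : Graph → ℕ → VSet → ℕ → ℕ → Set
Forces G k F v u = F v ≡ true × active G k F v ≡ true × adj G v u ≡ true

forceStep-extensive : F ⊆ˢ forceStep G k F
forceStep-extensive u e = ∨-trueˡ _ e

forceStep-true⇒ : forceStep G k F u ≡ true →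
  F u ≡ true ⊎ (F u ≡ false × ∃[ v ] v ∈ V G × Forces G k F v u)
forceStep-true⇒ {G} {k} {F} {u} e with F u
... | true  = inj₁ refl
... | false = let v , v∈V , p = to (any-true⇔ _ (V G)) e
                  Fv , act∧vu = to ∧-true⇔ p
              in inj₂ (refl , v , v∈V , Fv , to ∧-true⇔ act∧vu)

forces⇒forceStep-true : v ∈ V G → Forces G k F v u → forceStep G k F u ≡ true
forces⇒forceStep-true {v} {G} {k} {F} {u} v∈V (Fv , act , vu) =
  ∨-trueʳ (F u) (from (any-true⇔ _ (V G))
    (v , v∈V , from ∧-true⇔ (Fv , from ∧-true⇔ (act , vu))))

forceStep-⊆V : F ⊆V G → forceStep G k F ⊆V G
forceStep-⊆V {F} {G} F⊆V u e with forceStep-true⇒ {G} {F = F} e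
... | inj₁ Fu                       = F⊆V u Fu
... | inj₂ (_ , v , _ , _ , _ , vu) = adj⇒∈V {G} {v} vu

forceIter-⊆V : ∀ i → F ⊆V G → forceIter G k i F ⊆V G
forceIter-⊆V                 zero    F⊆V = F⊆V
forceIter-⊆V {G = G} {k = k} (suc i) F⊆V = forceStep-⊆V {G = G} {k = k} (forceIter-⊆V i F⊆V)

unforcedNbrs : Graph → VSet → ℕ → List ℕ
unforcedNbrs G F v = filter (λ u → T? (adj G v u ∧ not (F u))) (V G)

∈unforcedNbrs⇔ : ∀ G F v → u ∈ unforcedNbrs G F v ⇔ (adj G v u ≡ true × F u ≡ false)
∈unforcedNbrs⇔ G F v = mk⇔
  (λ m → let vu , ¬Fu = to T-∧ (proj₂ (∈-filter⁻ P {xs = V G} m)) in to T-≡ vu , to T-not-≡ ¬Fu)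
  (λ (vu , Fu) → ∈-filter⁺ P (adj⇒∈V {G} {v} vu) (from T-∧ (from T-≡ vu , from T-not-≡ Fu)))
  where P = λ u → T? (adj G v u ∧ not (F u))

outDeg-cong : (∀ u → (adj G v u ≡ true × F u ≡ false) ⇔ (adj H v u ≡ true × F′ u ≡ false)) →
  outDeg G F v ≡ outDeg H F′ v
outDeg-cong {G} {v} {F} {H} {F′} same = length-≡-if-same-elements
  (filter⁺ _ (V-uniq G)) (filter⁺ _ (V-uniq H))
  (λ u → mk⇔ (λ m → from (∈unforcedNbrs⇔ H F′ v) (to (same u) (to (∈unforcedNbrs⇔ G F v) m)))
             (λ m → from (∈unforcedNbrs⇔ G F v) (from (same u) (to (∈unforcedNbrs⇔ H F′ v) m))))

active-cong : outDeg G F v ≡ outDeg H F′ v → active G k F v ≡ active H k F′ v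
active-cong {k = k} = cong (λ n → (1 ≤ᵇ n) ∧ (n ≤ᵇ k))

DeleteEq-sym : DeleteEq G A H B → DeleteEq H B G A
DeleteEq-sym (sameV , sameAdj) =
  (λ v → ⇔-sym (sameV v)) ,
  (λ u v xu xv → sym (sameAdj u v (from (sameV u) xu) (from (sameV v) xv)))

BoundaryEq-sym : BoundaryEq G A H B → BoundaryEq H B G A
BoundaryEq-sym be v = sym (be v)

record Correspond (G : Graph) (A : VSet) (H : Graph) (B : VSet) (F F′ : VSet) : Set where
  field
    closedNbhd⊆ˡ : closedNbhd G A ⊆ˢ F
    closedNbhd⊆ʳ : closedNbhd H B ⊆ˢ F′
    agree-off    : ∀ u → InV∖ G A u → F u ≡ F′ u
open Correspond

Correspond-sym : DeleteEq G A H B → Correspond G A H B F F′ → Correspond H B G A F′ F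
Correspond-sym (sameV , _) c = record
  { closedNbhd⊆ˡ = closedNbhd⊆ʳ c
  ; closedNbhd⊆ʳ = closedNbhd⊆ˡ c
  ; agree-off    = λ u xu → sym (agree-off c u (from (sameV u) xu))
  }

unforced-transfer : DeleteEq G A H B → Correspond G A H B F F′ → InV∖ G A v →
  adj G v u ≡ true × F u ≡ false → adj H v u ≡ true × F′ u ≡ false
unforced-transfer {G} {A} {v = v} {u = u} (_ , sameAdj) c xv (vu , Fu) =
  trans (sym (sameAdj v u xv xu)) vu , trans (sym (agree-off c u xu)) Fu
  where
    xu : InV∖ G A u
    xu = adj⇒∈V {G} {v} vu , closedNbhd-false⇒∉ {G} (⊆ˢ-false (closedNbhd⊆ˡ c) Fu)

outDeg-transfer : DeleteEq G A H B → Correspond G A H B F F′ → InV∖ G A v →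
  outDeg G F v ≡ outDeg H F′ v
outDeg-transfer {G} {A} {H} {B} de c xv = outDeg-cong {G} {H = H} λ u → mk⇔
  (unforced-transfer de c xv)
  (unforced-transfer (DeleteEq-sym {G} {A} {H} {B} de) (Correspond-sym de c)
    (to (proj₁ de _) xv))

forces-transfer : DeleteEq G A H B → Correspond G A H B F F′ → F u ≡ false →
  v ∈ V G → Forces G k F v u → v ∈ V H × Forces H k F′ v u
forces-transfer {G} {A} {H} {u = u} {v} {k} de@(sameV , sameAdj) c Fu v∈V (Fv , act , vu) =
  proj₁ (to (sameV v) xv) ,
  trans (sym (agree-off c v xv)) Fv ,
  trans (sym (active-cong {G} {H = H} {k = k} (outDeg-transfer de c xv))) act ,
  trans (sym (sameAdj v u xv xu)) vu
  where
    N[A]u≡false : closedNbhd G A u ≡ false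
    N[A]u≡false = ⊆ˢ-false (closedNbhd⊆ˡ c) Fu
    xv : InV∖ G A v
    xv = v∈V , closedNbhd-false⇒nbr∉ {G} N[A]u≡false vu
    xu : InV∖ G A u
    xu = adj⇒∈V {G} {v} vu , closedNbhd-false⇒∉ {G} N[A]u≡false

forceStep-transfer : DeleteEq G A H B → Correspond G A H B F F′ → InV∖ G A u →
  forceStep G k F u ≡ true → forceStep H k F′ u ≡ true
forceStep-transfer {G} {H = H} {F = F} {F′ = F′} {k = k} de c xu e
  with forceStep-true⇒ {G} {k} {F} e
... | inj₁ Fu = forceStep-extensive {F = F′} {H} {k} _ (trans (sym (agree-off c _ xu)) Fu)
... | inj₂ (Fu , v , v∈V , f) =
  let v∈V′ , f′ = forces-transfer {k = k} de c Fu v∈V f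
  in forces⇒forceStep-true {G = H} v∈V′ f′

forceStep-Correspond : DeleteEq G A H B → Correspond G A H B F F′ →
  Correspond G A H B (forceStep G k F) (forceStep H k F′)
forceStep-Correspond {G} {A} {H} {B} {F} {F′} {k} de c = record
  { closedNbhd⊆ˡ = λ u e → forceStep-extensive {F = F} {G} {k} u (closedNbhd⊆ˡ c u e)
  ; closedNbhd⊆ʳ = λ u e → forceStep-extensive {F = F′} {H} {k} u (closedNbhd⊆ʳ c u e)
  ; agree-off    = λ u xu → ⇔→≡ (mk⇔
      (forceStep-transfer {k = k} de c xu)
      (forceStep-transfer {k = k} (DeleteEq-sym {G} {A} {H} {B} de) (Correspond-sym de c)
        (to (proj₁ de u) xu)))
  }

closedNbhd-Correspond : DeleteEq G A H B → BoundaryEq G A H B →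
  Correspond G A H B (closedNbhd G A) (closedNbhd H B)
closedNbhd-Correspond {G} {A} {H} {B} (sameV , _) be = record
  { closedNbhd⊆ˡ = λ _ e → e
  ; closedNbhd⊆ʳ = λ _ e → e
  ; agree-off    = agree
  }
  where
    agree : ∀ u → InV∖ G A u → closedNbhd G A u ≡ closedNbhd H B u
    agree u xu = begin
      closedNbhd G A u                ≡⟨ sym (∧-identityʳ _) ⟩
      closedNbhd G A u ∧ not false    ≡⟨ cong (λ b → closedNbhd G A u ∧ not b) (sym (proj₂ xu)) ⟩
      closedNbhd G A u ∧ not (A u)    ≡⟨ be u ⟩
      closedNbhd H B u ∧ not (B u)    ≡⟨ cong (λ b → closedNbhd H B u ∧ not b) (proj₂ (to (sameV u) xu)) ⟩
      closedNbhd H B u ∧ not false    ≡⟨ ∧-identityʳ _ ⟩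
      closedNbhd H B u                ∎
      where open ≡-Reasoning

powerIter-Correspond : DeleteEq G A H B → BoundaryEq G A H B → ∀ ℓ →
  Correspond G A H B (powerIter G k ℓ A) (powerIter H k ℓ B)
powerIter-Correspond         de be zero    = closedNbhd-Correspond de be
powerIter-Correspond {k = k} de be (suc ℓ) =
  forceStep-Correspond {k = k} de (powerIter-Correspond de be ℓ)

EqualsV-transfer : DeleteEq G A H B → Correspond G A H B F F′ → F′ ⊆V H →
  EqualsV G F → EqualsV H F′
EqualsV-transfer {H = H} {B} {F′ = F′} (sameV , _) c F′⊆V F≡V v = mk⇔ (F′⊆V v) covers
  where
    covers : v ∈ V H → F′ v ≡ true
    covers v∈V with B v in Bv
    ... | true  = closedNbhd⊆ʳ c v (⊆closedNbhd {B} {H} v Bv)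
    ... | false = let xv = from (sameV v) (v∈V , Bv)
                  in trans (sym (agree-off c v xv)) (from (F≡V v) (proj₁ xv))

IsKPowerDomSet-transfer : B ⊆V H → DeleteEq G A H B → BoundaryEq G A H B →
  IsKPowerDomSet G k A → IsKPowerDomSet H k B
IsKPowerDomSet-transfer {B} {H} {k = k} B⊆V de be (ℓ , N≡V) =
  ℓ , EqualsV-transfer de (powerIter-Correspond {k = k} de be ℓ)
        (forceIter-⊆V {G = H} {k = k} ℓ (closedNbhd-⊆V {B} {H} B⊆V)) N≡V

-- 𝓟^ℓ(A) is 𝓕^ℓ(N[A]) by definition, so both parts are the same equivalence.
lemma3p11 : (k : ℕ) (G H : Graph) (A B : VSet) → A ⊆V G → B ⊆V H →
    DeleteEq G A H B → BoundaryEq G A H B →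
    (IsKPowerDomSet G k A ⇔ IsKPowerDomSet H k B) ×
    (IsKForcingSet G k (closedNbhd G A) ⇔ IsKForcingSet H k (closedNbhd H B))
lemma3p11 k G H A B A⊆V B⊆V de be = powerDom⇔ , powerDom⇔
  where
    powerDom⇔ : IsKPowerDomSet G k A ⇔ IsKPowerDomSet H k B
    powerDom⇔ = mk⇔
      (IsKPowerDomSet-transfer B⊆V de be)
      (IsKPowerDomSet-transfer A⊆V (DeleteEq-sym {G} {A} {H} {B} de)
                                   (BoundaryEq-sym {G} {A} {H} {B} be))
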